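{- Let $\mathcal{N}=\mathbb{N}^{\mathbb{N}}$, $X=\{\alpha\in\mathcal{N}:\alpha(0)>0\}$, $Y=\{\alpha\in\mathcal{N}:\alpha(0)=0\}$, $D=\{(\alpha,\alpha):\alpha\in\mathcal{N}\}$. Let $E\subseteq X\times X$ be an analytic equivalence relation and let $F\subseteq X\times X\times X$ be a closed set with $(\alpha,\beta,\gamma)\in F\iff(\beta,\alpha,\gamma)\in F$ and such that for all $\alpha,\beta\in X$, $(\alpha,\beta)\in E\iff\exists\gamma\,(\alpha,\beta,\gamma)\in F$. Let $f\colon X\to Y$ and $g\colon Y^3\to Y$ be homeomorphisms, $j(\alpha,\beta,\gamma)=g(f(\alpha),f(\beta),f(\gamma))$ for $\alpha,\beta,\gamma\in X$, and define $G=\{(\alpha,j(\alpha,\beta,\gamma)):(\alpha,\beta,\gamma)\in F\}$, $G^T=\{(y,x):(x,y)\in G\}$, $H=\{(j(\alpha,\beta,\gamma),j(\beta,\alpha,\gamma)):(\alpha,\beta,\gamma)\in X^3\}$, $I=D\cup G\cup G^T\cup (G^T\circ G)$, $J=D\cup H$. Then $I$ and $J$ are equivalence relations on $\mathcal{N}$.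
   Context: Composition of relations is written left to right: $(a,c)\in K\circ L$ iff there is $b$ with $(a,b)\in K$ and $(b,c)\in L$. -}

module Defs where

open import Data.Nat using (ℕ; zero; suc; _<_)
open import Data.Product using (Σ; ∃; ∃-syntax; _×_; _,_)
open import Relation.Binary.PropositionalEquality using (_≡_)
open import Data.Sum using (_⊎_)
open import Data.Unit using (⊤)

𝒩 : Set
𝒩 = ℕ → ℕ

infix 4 _≈_ _≈[_]_
_≈_ : 𝒩 → 𝒩 → Set
α ≈ β = ∀ n → α n ≡ β n

-- α and β agree on the first n coordinates (basic neighbourhoods).
_≈[_]_ : 𝒩 → ℕ → 𝒩 → Set
α ≈[ n ] β = ∀ i → i < n → α i ≡ β i

X : 𝒩 → Set
X α = 0 < α 0

Y : 𝒩 → Set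
Y α = α 0 ≡ 0

-- Closed subsets of 𝒩³ (product topology): closed under limits, i.e. a
-- point all of whose basic neighbourhoods meet the set belongs to it.
Closed³ : (𝒩 → 𝒩 → 𝒩 → Set) → Set
Closed³ C = ∀ α β γ →
  (∀ n → ∃[ α' ] ∃[ β' ] ∃[ γ' ]
           (C α' β' γ' × α ≈[ n ] α' × β ≈[ n ] β' × γ ≈[ n ] γ')) →
  C α β γ

-- Analytic subset of 𝒩²: projection of a closed subset of 𝒩² × 𝒩.
Analytic² : (𝒩 → 𝒩 → Set) → Set₁
Analytic² E = ∃[ C ] (Closed³ C ×
  (∀ α β → (E α β → ∃[ γ ] C α β γ) × (∃[ γ ] C α β γ → E α β)))

ContinuousOn : (𝒩 → Set) → (𝒩 → 𝒩) → Set
ContinuousOn A h = ∀ α → A α → ∀ n → ∃[ m ] ∀ β → A β → α ≈[ m ] β → h α ≈[ n ] h β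

ContinuousOn³ : (𝒩 → Set) → (𝒩 → 𝒩 → 𝒩 → 𝒩) → Set
ContinuousOn³ A h = ∀ α β γ → A α → A β → A γ → ∀ n → ∃[ m ] ∀ α' β' γ' →
  A α' → A β' → A γ' → α ≈[ m ] α' → β ≈[ m ] β' → γ ≈[ m ] γ' →
  h α β γ ≈[ n ] h α' β' γ'

-- f : A → B is a homeomorphism (represented by a map 𝒩 → 𝒩 whose values
-- off A are irrelevant).
record Homeo (A B : 𝒩 → Set) (f : 𝒩 → 𝒩) : Set where
  field
    maps   : ∀ α → A α → B (f α)
    cont   : ContinuousOn A f
    inv    : 𝒩 → 𝒩
    inv-maps : ∀ β → B β → A (inv β)
    inv-cont : ContinuousOn B inv
    inv-left  : ∀ α → A α → inv (f α) ≈ α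
    inv-right : ∀ β → B β → f (inv β) ≈ β

record Homeo³ (A B : 𝒩 → Set) (g : 𝒩 → 𝒩 → 𝒩 → 𝒩) : Set where
  field
    maps : ∀ α β γ → A α → A β → A γ → B (g α β γ)
    cont : ContinuousOn³ A g
    inv₁ inv₂ inv₃ : 𝒩 → 𝒩
    inv₁-maps : ∀ β → B β → A (inv₁ β)
    inv₂-maps : ∀ β → B β → A (inv₂ β)
    inv₃-maps : ∀ β → B β → A (inv₃ β)
    inv₁-cont : ContinuousOn B inv₁
    inv₂-cont : ContinuousOn B inv₂
    inv₃-cont : ContinuousOn B inv₃
    inv-left : ∀ α β γ → A α → A β → A γ →
      (inv₁ (g α β γ) ≈ α) × (inv₂ (g α β γ) ≈ β) × (inv₃ (g α β γ) ≈ γ)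
    inv-right : ∀ δ → B δ → g (inv₁ δ) (inv₂ δ) (inv₃ δ) ≈ δ

-- Relations on 𝒩 (subsets of 𝒩 × 𝒩, hence invariant under ≈).
Rel𝒩 : Set₁
Rel𝒩 = 𝒩 → 𝒩 → Set

record IsEquivOn (A : 𝒩 → Set) (R : Rel𝒩) : Set where
  field
    resp  : ∀ {α α' β β'} → α ≈ α' → β ≈ β' → R α β → R α' β'
    refl  : ∀ α → A α → R α α
    sym   : ∀ {α β} → R α β → R β α
    trans : ∀ {α β γ} → R α β → R β γ → R α γ

IsEquiv : Rel𝒩 → Set
IsEquiv = IsEquivOn (λ _ → ⊤)

module Construction (F : 𝒩 → 𝒩 → 𝒩 → Set) (f : 𝒩 → 𝒩) (g : 𝒩 → 𝒩 → 𝒩 → 𝒩) where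

  j : 𝒩 → 𝒩 → 𝒩 → 𝒩
  j α β γ = g (f α) (f β) (f γ)

  D : Rel𝒩
  D x y = x ≈ y

  G : Rel𝒩
  G x y = ∃[ α ] ∃[ β ] ∃[ γ ] (F α β γ × x ≈ α × y ≈ j α β γ)

  Gᵀ : Rel𝒩
  Gᵀ x y = G y x

  -- left-to-right composition: (a,c) ∈ K ∘ L iff ∃ b, (a,b) ∈ K, (b,c) ∈ L
  _∘ᴿ_ : Rel𝒩 → Rel𝒩 → Rel𝒩
  (K ∘ᴿ L) a c = ∃[ b ] (K a b × L b c)

  H : Rel𝒩
  H x y = ∃[ α ] ∃[ β ] ∃[ γ ] (X α × X β × X γ × x ≈ j α β γ × y ≈ j β α γ)

  _∪ᴿ_ : Rel𝒩 → Rel𝒩 → Rel𝒩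
  (K ∪ᴿ L) a b = K a b ⊎ L a b

  I : Rel𝒩
  I = D ∪ᴿ (G ∪ᴿ (Gᵀ ∪ᴿ (Gᵀ ∘ᴿ G)))

  J : Rel𝒩
  J = D ∪ᴿ H

module Submission where

-- Both I and J have the shape "R ⁼", the reflexive closure
-- D ∪ R of a relation R that respects pointwise equality ≈.  Such a closure
-- is an equivalence relation as soon as R is symmetric and R ∘ R ⊆ D ∪ R.
--
-- For J take R = H: H is symmetric by swapping α and β, and H ∘ H ⊆ D
-- because j is injective, so j(β,α,γ) = j(α',β',γ') forces α' = β,
-- β' = α, γ' = γ and then j(β',α',γ') = j(α,β,γ).
--
-- For I take R = G ∪ Gᵀ ∪ (Gᵀ ∘ G), the "symmetrization" of G.  This is a
-- purely relational fact: whenever G has no chains (G ⊆ X × Y with X, Y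
-- disjoint) and is co-injective (G a c, G b c ⇒ a = b, again by injectivity
-- of j), its symmetrization composes into its reflexive closure.

open import Defs
open import Data.Nat using (ℕ; suc; _<_)
open import Data.Nat.Properties using (n<1+n)
open import Data.Product using (_×_; ∃-syntax; _,_)
open import Data.Sum using (_⊎_; inj₁; inj₂)
open import Data.Empty using (⊥; ⊥-elim)
open import Level using (0ℓ)
open import Relation.Binary.Bundles using (Setoid)
open import Relation.Binary.PropositionalEquality as Eq using (subst; _→-setoid_)
import Relation.Binary.Reasoning.Setoid as SetoidReasoning

𝒩-setoid : Setoid 0ℓ 0ℓ
𝒩-setoid = ℕ →-setoid ℕ

open Setoid 𝒩-setoid using ()
  renaming (refl to ≈-refl; sym to ≈-sym; trans to ≈-trans)
open SetoidReasoning 𝒩-setoid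

≈⇒≈[_] : ∀ n {α β} → α ≈ β → α ≈[ n ] β
≈⇒≈[ n ] α≈β i _ = α≈β i

≈[]⇒≈ : ∀ {α β : 𝒩} → (∀ n → α ≈[ n ] β) → α ≈ β
≈[]⇒≈ agree i = agree (suc i) i (n<1+n i)

continuous⇒resp : ∀ {A h} → ContinuousOn A h →
  ∀ {α β} → A α → A β → α ≈ β → h α ≈ h β
continuous⇒resp {h = h} cont {α} {β} Aα Aβ α≈β = ≈[]⇒≈ agree
  where
  agree : ∀ n → h α ≈[ n ] h β
  agree n with cont α Aα n
  ... | m , close = close β Aβ (≈⇒≈[ m ] α≈β)

continuous³⇒resp : ∀ {A h} → ContinuousOn³ A h →
  ∀ {α β γ α' β' γ'} → A α → A β → A γ → A α' → A β' → A γ' →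
  α ≈ α' → β ≈ β' → γ ≈ γ' → h α β γ ≈ h α' β' γ'
continuous³⇒resp {h = h} cont {α} {β} {γ} {α'} {β'} {γ'}
  Aα Aβ Aγ Aα' Aβ' Aγ' e₁ e₂ e₃ = ≈[]⇒≈ agree
  where
  agree : ∀ n → h α β γ ≈[ n ] h α' β' γ'
  agree n with cont α β γ Aα Aβ Aγ n
  ... | m , close = close α' β' γ' Aα' Aβ' Aγ' (≈⇒≈[ m ] e₁) (≈⇒≈[ m ] e₂) (≈⇒≈[ m ] e₃)

-- A continuous retraction k recovers a from x (k x ≈ a); hence points with
-- equal images under a map admitting k were equal.
retraction-reflects : ∀ {B k} → ContinuousOn B k →
  ∀ {x y a b} → B x → B y → k x ≈ a → k y ≈ b → x ≈ y → a ≈ b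
retraction-reflects {k = k} cont {x} {y} {a} {b} Bx By kx≈a ky≈b x≈y = begin
  a    ≈⟨ ≈-sym kx≈a ⟩
  k x  ≈⟨ continuous⇒resp cont Bx By x≈y ⟩
  k y  ≈⟨ ky≈b ⟩
  b    ∎

homeo-injective : ∀ {A B f} → Homeo A B f →
  ∀ {α β} → A α → A β → f α ≈ f β → α ≈ β
homeo-injective {f = f} hf {α} {β} Aα Aβ =
  retraction-reflects inv-cont (maps α Aα) (maps β Aβ) (inv-left α Aα) (inv-left β Aβ)
  where open Homeo hf

homeo³-injective : ∀ {A B g} → Homeo³ A B g →
  ∀ {α β γ α' β' γ'} → A α → A β → A γ → A α' → A β' → A γ' →
  g α β γ ≈ g α' β' γ' → (α ≈ α') × (β ≈ β') × (γ ≈ γ')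
homeo³-injective {B = B} {g} hg {α} {β} {γ} {α'} {β'} {γ'} Aα Aβ Aγ Aα' Aβ' Aγ' e =
  let (l₁ , l₂ , l₃) = inv-left α β γ Aα Aβ Aγ
      (l₁' , l₂' , l₃') = inv-left α' β' γ' Aα' Aβ' Aγ'
  in reflect inv₁-cont l₁ l₁' , reflect inv₂-cont l₂ l₂' , reflect inv₃-cont l₃ l₃'
  where
  open Homeo³ hg
  reflect : ∀ {k a b} → ContinuousOn B k →
    k (g α β γ) ≈ a → k (g α' β' γ') ≈ b → a ≈ b
  reflect cont la lb =
    retraction-reflects cont (maps α β γ Aα Aβ Aγ) (maps α' β' γ' Aα' Aβ' Aγ') la lb e

X-resp : ∀ {α β} → α ≈ β → X α → X β
X-resp α≈β = subst (0 <_) (α≈β 0)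

Y-resp : ∀ {α β} → α ≈ β → Y α → Y β
Y-resp α≈β Yα = Eq.trans (Eq.sym (α≈β 0)) Yα

X∩Y-empty : ∀ {α} → X α → Y α → ⊥
X∩Y-empty Xα Yα with subst (0 <_) Yα Xα
... | ()

Respects≈ : Rel𝒩 → Set
Respects≈ R = ∀ {α α' β β'} → α ≈ α' → β ≈ β' → R α β → R α' β'

_⁼ : Rel𝒩 → Rel𝒩
(R ⁼) α β = α ≈ β ⊎ R α β

pattern same e    = inj₁ e
pattern related r = inj₂ r

reflexive-closure-equiv : ∀ {R} → Respects≈ R → (∀ {α β} → R α β → R β α) →
  (∀ {α β γ} → R α β → R β γ → (R ⁼) α γ) → IsEquiv (R ⁼)
reflexive-closure-equiv {R} R-resp R-sym R-compose = record
  { resp  = resp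
  ; refl  = λ _ _ → same ≈-refl
  ; sym   = λ { (same e) → same (≈-sym e) ; (related r) → related (R-sym r) }
  ; trans = trans
  }
  where
  resp : Respects≈ (R ⁼)
  resp e₁ e₂ (same e)    = same (≈-trans (≈-sym e₁) (≈-trans e e₂))
  resp e₁ e₂ (related r) = related (R-resp e₁ e₂ r)

  trans : ∀ {α β γ} → (R ⁼) α β → (R ⁼) β γ → (R ⁼) α γ
  trans (same e)    q           = resp (≈-sym e) ≈-refl q
  trans p           (same e)    = resp ≈-refl e p
  trans (related r) (related s) = R-compose r s

Symmetrization : Rel𝒩 → Rel𝒩
Symmetrization G α β = G α β ⊎ (G β α ⊎ ∃[ δ ] (G δ α × G δ β))

pattern forward p      = inj₁ p
pattern backward p     = inj₂ (inj₁ p)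
pattern through δ p q = inj₂ (inj₂ (δ , p , q))

symmetrization-equiv : ∀ {G} → Respects≈ G →
  (∀ {α β γ} → G α β → G β γ → ⊥) →
  (∀ {α β γ} → G α γ → G β γ → α ≈ β) →
  IsEquiv (Symmetrization G ⁼)
symmetrization-equiv {G} G-resp no-chain co-injective =
  reflexive-closure-equiv resp sym compose
  where
  S = Symmetrization G

  move : ∀ {α α' β} → α ≈ α' → G α β → G α' β
  move e = G-resp e ≈-refl

  resp : Respects≈ S
  resp e₁ e₂ (forward p)     = forward (G-resp e₁ e₂ p)
  resp e₁ e₂ (backward p)    = backward (G-resp e₂ e₁ p)
  resp e₁ e₂ (through δ p q) = through δ (G-resp ≈-refl e₁ p) (G-resp ≈-refl e₂ q)

  sym : ∀ {α β} → S α β → S β α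
  sym (forward p)     = backward p
  sym (backward p)    = forward p
  sym (through δ p q) = through δ q p

  compose : ∀ {α β γ} → S α β → S β γ → (S ⁼) α γ
  compose (forward p)     (forward q)     = ⊥-elim (no-chain p q)
  compose (forward p)     (backward q)    = same (co-injective p q)
  compose (forward p)     (through _ q r) = related (forward (move (co-injective q p) r))
  compose (backward p)    (forward q)     = related (through _ p q)
  compose (backward p)    (backward q)    = ⊥-elim (no-chain q p)
  compose (backward p)    (through _ q _) = ⊥-elim (no-chain q p)
  compose (through _ _ q) (forward r)     = ⊥-elim (no-chain q r)
  compose (through _ p q) (backward r)    = related (backward (move (co-injective q r) p))
  compose (through δ p q) (through _ r s) = related (through δ p (move (co-injective r q) s))

module Properties (F : 𝒩 → 𝒩 → 𝒩 → Set) (f : 𝒩 → 𝒩) (g : 𝒩 → 𝒩 → 𝒩 → 𝒩)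
  (F⊆X³ : ∀ α β γ → F α β γ → X α × X β × X γ)
  (hf : Homeo X Y f) (hg : Homeo³ Y Y g) where

  open Construction F f g

  f-Y : ∀ {δ} → X δ → Y (f δ)
  f-Y {δ} = Homeo.maps hf δ

  j-Y : ∀ {α β γ} → X α → X β → X γ → Y (j α β γ)
  j-Y {α} {β} {γ} Xα Xβ Xγ = Homeo³.maps hg (f α) (f β) (f γ) (f-Y Xα) (f-Y Xβ) (f-Y Xγ)

  j-resp : ∀ {α β γ α' β' γ'} → X α → X β → X γ → X α' → X β' → X γ' →
    α ≈ α' → β ≈ β' → γ ≈ γ' → j α β γ ≈ j α' β' γ'
  j-resp Xα Xβ Xγ Xα' Xβ' Xγ' e₁ e₂ e₃ =
    continuous³⇒resp (Homeo³.cont hg) (f-Y Xα) (f-Y Xβ) (f-Y Xγ) (f-Y Xα') (f-Y Xβ') (f-Y Xγ')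
      (f-resp Xα Xα' e₁) (f-resp Xβ Xβ' e₂) (f-resp Xγ Xγ' e₃)
    where f-resp = continuous⇒resp (Homeo.cont hf)

  j-injective : ∀ {α β γ α' β' γ'} → X α → X β → X γ → X α' → X β' → X γ' →
    j α β γ ≈ j α' β' γ' → (α ≈ α') × (β ≈ β') × (γ ≈ γ')
  j-injective Xα Xβ Xγ Xα' Xβ' Xγ' e =
    let (e₁ , e₂ , e₃) = homeo³-injective hg
                           (f-Y Xα) (f-Y Xβ) (f-Y Xγ) (f-Y Xα') (f-Y Xβ') (f-Y Xγ') e
    in f-injective Xα Xα' e₁ , f-injective Xβ Xβ' e₂ , f-injective Xγ Xγ' e₃
    where f-injective = homeo-injective hf

  G-resp : Respects≈ G
  G-resp e₁ e₂ (α , β , γ , Fαβγ , x≈α , y≈j) =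
    α , β , γ , Fαβγ , ≈-trans (≈-sym e₁) x≈α , ≈-trans (≈-sym e₂) y≈j

  G-X×Y : ∀ {x y} → G x y → X x × Y y
  G-X×Y (α , β , γ , Fαβγ , x≈α , y≈j) =
    let (Xα , Xβ , Xγ) = F⊆X³ α β γ Fαβγ
    in X-resp (≈-sym x≈α) Xα , Y-resp (≈-sym y≈j) (j-Y Xα Xβ Xγ)

  G-no-chain : ∀ {x y z} → G x y → G y z → ⊥
  G-no-chain {y = y} p q =
    let (_ , Yy) = G-X×Y p
        (Xy , _) = G-X×Y q
    in X∩Y-empty {y} Xy Yy

  -- A point y = j(α,β,γ) determines α, hence the G-predecessor of y.
  G-co-injective : ∀ {x x' y} → G x y → G x' y → x ≈ x'
  G-co-injective (α , β , γ , Fαβγ , x≈α , y≈j) (α' , β' , γ' , Fα'β'γ' , x'≈α' , y≈j') =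
    let (Xα , Xβ , Xγ) = F⊆X³ α β γ Fαβγ
        (Xα' , Xβ' , Xγ') = F⊆X³ α' β' γ' Fα'β'γ'
        (α≈α' , _) = j-injective Xα Xβ Xγ Xα' Xβ' Xγ' (≈-trans (≈-sym y≈j) y≈j')
    in ≈-trans x≈α (≈-trans α≈α' (≈-sym x'≈α'))

  H-resp : Respects≈ H
  H-resp e₁ e₂ (α , β , γ , Xα , Xβ , Xγ , x≈j , y≈j) =
    α , β , γ , Xα , Xβ , Xγ , ≈-trans (≈-sym e₁) x≈j , ≈-trans (≈-sym e₂) y≈j

  H-sym : ∀ {x y} → H x y → H y x
  H-sym (α , β , γ , Xα , Xβ , Xγ , x≈j , y≈j) = β , α , γ , Xβ , Xα , Xγ , y≈j , x≈j

  -- Two H-steps j(α,β,γ) ↦ j(β,α,γ) = j(α',β',γ') ↦ j(β',α',γ') return to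
  -- the start, since injectivity of j gives α' ≈ β, β' ≈ α, γ' ≈ γ.
  H-H⊆D : ∀ {x y z} → H x y → H y z → x ≈ z
  H-H⊆D {x} {y} {z} (α , β , γ , Xα , Xβ , Xγ , x≈j , y≈j)
                    (α' , β' , γ' , Xα' , Xβ' , Xγ' , y≈j' , z≈j') =
    let (β≈α' , α≈β' , γ≈γ') = j-injective Xβ Xα Xγ Xα' Xβ' Xγ' (≈-trans (≈-sym y≈j) y≈j')
    in begin
      x            ≈⟨ x≈j ⟩
      j α β γ      ≈⟨ j-resp Xα Xβ Xγ Xβ' Xα' Xγ' α≈β' β≈α' γ≈γ' ⟩
      j β' α' γ'   ≈⟨ ≈-sym z≈j' ⟩
      z            ∎

  I-equiv : IsEquiv I
  I-equiv = symmetrization-equiv G-resp G-no-chain G-co-injective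

  J-equiv : IsEquiv J
  J-equiv = reflexive-closure-equiv H-resp H-sym (λ p q → same (H-H⊆D p q))

lemma4 : (E : 𝒩 → 𝒩 → Set) (F : 𝒩 → 𝒩 → 𝒩 → Set) (f : 𝒩 → 𝒩) (g : 𝒩 → 𝒩 → 𝒩 → 𝒩) →
    (∀ α β → E α β → X α × X β) →
    IsEquivOn X E →
    Analytic² E →
    (∀ α β γ → F α β γ → X α × X β × X γ) →
    Closed³ F →
    (∀ α β γ → (F α β γ → F β α γ) × (F β α γ → F α β γ)) →
    (∀ α β → X α → X β → (E α β → ∃[ γ ] F α β γ) × (∃[ γ ] F α β γ → E α β)) →
    Homeo X Y f →
    Homeo³ Y Y g →
    IsEquiv (Construction.I F f g) × IsEquiv (Construction.J F f g)
lemma4 _ F f g _ _ _ F⊆X³ _ _ _ hf hg = I-equiv , J-equiv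
  where open Properties F f g F⊆X³ hf hg
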